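{- For every finite sequence $L$ of colored items, $\mathrm{OPT}(L) \geq \mathrm{LB}_2(L)$, where, writing the items of $L$ as $1,\dots,n$, setting $s_{c,\ell}=1$ if item $\ell$ has color $c$ and $s_{c,\ell}=-1$ otherwise, \[ \mathrm{LB}_2(L) = \max_{c \in C}\ \max_{1\le i\le j\le n}\ \sum_{\ell=i}^{j} s_{c,\ell}. \]
   Context: Colored Bin Packing: items arrive as a sequence; each item has a size in $[0,1]$ and a color from a finite set $C$. A packing assigns every item to a bin of unit capacity; the items in a bin are ordered by their position in the input sequence (no reordering). A packing is valid if in every bin the total size is at most $1$ and no two items that are consecutive in that bin (in this order) have the same color. $\mathrm{OPT}(L)$ denotes the minimum number of bins in a valid packing of the sequence $L$ (the restricted offline optimum, i.e., without reordering). $\mathrm{LB}_2$ is called the maximal color discrepancy of the sequence.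
   Formalization: The item sizes are rational numbers in $[0,1]$. -}

module Defs where

open import Data.Nat using (ℕ; _<_; _≤_)
open import Data.Fin using (Fin; toℕ)
open import Data.Integer as ℤ using (ℤ; +_; -_)
open import Data.Rational as ℚ using (ℚ; 0ℚ; 1ℚ)
open import Data.List using (List; length; lookup; map; filter; sum)
open import Data.List as L using ()
open import Data.Product using (_×_; Σ; _,_)
open import Relation.Binary.PropositionalEquality using (_≡_; _≢_)
open import Relation.Nullary using (¬_)
open import Data.Fin using (_≟_)

record Item (k : ℕ) : Set where
  constructor item
  field
    size     : ℚ
    size≥0   : 0ℚ ℚ.≤ size
    size≤1   : size ℚ.≤ 1ℚ
    color    : Fin k
open Item public

Seq : ℕ → Set
Seq k = List (Item k)

Pos : ∀ {k} → Seq k → Set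
Pos L = Fin (length L)

Packing : ∀ {k} → Seq k → ℕ → Set
Packing L m = Pos L → Fin m

sumℚ : List ℚ → ℚ
sumℚ = L.foldr ℚ._+_ 0ℚ

load : ∀ {k m} (L : Seq k) → Packing L m → Fin m → ℚ
load L P b =
  sumℚ (map (λ i → size (lookup L i))
            (filter (λ i → P i ≟ b) (L.allFin (length L))))

ConsecutiveIn : ∀ {k m} (L : Seq k) → Packing L m → Pos L → Pos L → Set
ConsecutiveIn L P i j =
  (toℕ i < toℕ j) × (P i ≡ P j) ×
  ((l : Pos L) → toℕ i < toℕ l → toℕ l < toℕ j → P l ≢ P i)

Valid : ∀ {k m} (L : Seq k) → Packing L m → Set
Valid {m = m} L P =
  ((b : Fin m) → load L P b ℚ.≤ 1ℚ) ×
  ((i j : Pos L) → ConsecutiveIn L P i j → color (lookup L i) ≢ color (lookup L j))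

s : ∀ {k} → Fin k → Item k → ℤ
s c x with color x ≟ c
... | Relation.Nullary.yes _ = + 1
... | Relation.Nullary.no  _ = - (+ 1)

-- Σ_{ℓ=i}^{j} s_{c,ℓ}  (0-based positions, i ≤ j inclusive)
discrepancy : ∀ {k} → Fin k → (L : Seq k) → ℕ → ℕ → ℤ
discrepancy c L i j =
  L.foldr ℤ._+_ (+ 0) (map (s c) (L.take (Data.Nat._∸_ (Data.Nat._+_ j 1) i) (L.drop i L)))

module Submission where

-- Fix a color c and scan the window of
-- positions i, i+1, …, j from left to right.  Maintain the set S of bins that
-- are "armed": the last window item already placed in such a bin has color c.
-- By validity, an armed bin can never receive a c-colored item next, so
--   * a c-colored item goes to an unarmed bin, which becomes armed: the running
--     discrepancy and ∣S∣ both grow by exactly 1;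
--   * any other item lowers the discrepancy by 1 and disarms at most one bin.
-- Each step thus raises (discrepancy scanned so far) − ∣S∣ by at most 0, so the
-- discrepancy of the window is at most ∣S_end∣ − ∣S_start∣ ≤ m − 0 = m.
-- Formally we only keep the consequence of "armed" that matters: the next item
-- of an armed bin is not c-colored (the invariant Guarded).

open import Defs
open import Data.Nat using (ℕ; _≤_; _<_)
open import Data.Fin using (Fin)
open import Data.List using (length)
open import Data.Integer as ℤ using (+_)

open import Data.Nat using (zero; suc; _+_; _∸_; z≤n; s≤s)
import Data.Nat.Properties as ℕₚ
import Data.Integer.Properties as ℤₚ
open import Data.Fin using (toℕ; fromℕ<) renaming (_≟_ to _≟ᶠ_)
open import Data.Fin.Properties using (toℕ-fromℕ<; toℕ-injective)
open import Data.Fin.Subset as Subset using (Subset; inside; outside; ∣_∣)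
open import Data.Fin.Subset.Properties using (∣p∣≤n; ∣⊥∣≡0)
open import Data.Vec using (_∷_; lookup; _[_]≔_)
open import Data.Vec.Properties using (lookup∘update; lookup∘update′; lookup-replicate)
open import Data.List as List using (List)
open import Data.Product using (_,_; proj₂; Σ-syntax)
open import Relation.Nullary using (¬_; yes; no; does; contradiction)
open import Relation.Binary.PropositionalEquality

size-insert : ∀ {n} (S : Subset n) (b : Fin n) →
  lookup S b ≡ outside → ∣ S [ b ]≔ inside ∣ ≡ suc ∣ S ∣
size-insert (outside ∷ S) Fin.zero    _ = refl
size-insert (inside  ∷ S) (Fin.suc b) e = cong suc (size-insert S b e)
size-insert (outside ∷ S) (Fin.suc b) e = size-insert S b e

size-remove : ∀ {n} (S : Subset n) (b : Fin n) → ∣ S ∣ ≤ suc ∣ S [ b ]≔ outside ∣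
size-remove (inside  ∷ S) Fin.zero    = ℕₚ.≤-refl
size-remove (outside ∷ S) Fin.zero    = ℕₚ.n≤1+n _
size-remove (inside  ∷ S) (Fin.suc b) = s≤s (size-remove S b)
size-remove (outside ∷ S) (Fin.suc b) = size-remove S b

drop-lookup : ∀ {A : Set} (xs : List A) (p : Fin (length xs)) →
  List.drop (toℕ p) xs ≡ List.lookup xs p List.∷ List.drop (suc (toℕ p)) xs
drop-lookup (x List.∷ xs) Fin.zero    = refl
drop-lookup (x List.∷ xs) (Fin.suc p) = drop-lookup xs p

-- The color discrepancy of the t items starting at position a; by definition
-- discrepancy c L i j = window-sum c L i (j + 1 ∸ i).
window-sum : ∀ {k} → Fin k → Seq k → ℕ → ℕ → ℤ.ℤ
window-sum c L a t = List.foldr ℤ._+_ (+ 0) (List.map (s c) (List.take t (List.drop a L)))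

window-sum-step : ∀ {k} (c : Fin k) (L : Seq k) (p : Pos L) (t : ℕ) →
  window-sum c L (toℕ p) (suc t) ≡ s c (List.lookup L p) ℤ.+ window-sum c L (suc (toℕ p)) t
window-sum-step c L p t rewrite drop-lookup L p = refl

module Scan {k m} (L : Seq k) (P : Packing L m) (valid : Valid L P) (c : Fin k) where

  colorAt : Pos L → Fin k
  colorAt q = color (List.lookup L q)

  FirstFrom : ℕ → Pos L → Set
  FirstFrom a q = ∀ (l : Pos L) → a ≤ toℕ l → toℕ l < toℕ q → P l ≢ P q

  Guarded : Subset m → ℕ → Set
  Guarded S a = ∀ (q : Pos L) → lookup S (P q) ≡ inside → a ≤ toℕ q →
    colorAt q ≡ c → ¬ FirstFrom a q

  next : Subset m → Pos L → Subset m
  next S p = S [ P p ]≔ does (colorAt p ≟ᶠ c)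

  -- A c-colored item at the scan position is first in its bin, so that bin is unarmed.
  unarmed : ∀ S (p : Pos L) → Guarded S (toℕ p) → colorAt p ≡ c → lookup S (P p) ≡ outside
  unarmed S p g pc with lookup S (P p) in armed
  ... | outside = refl
  ... | inside  = contradiction (λ l p≤l l<p _ → ℕₚ.<⇒≱ l<p p≤l) (g p armed ℕₚ.≤-refl pc)

  first-extend : ∀ (p q : Pos L) → P q ≢ P p → FirstFrom (suc (toℕ p)) q → FirstFrom (toℕ p) q
  first-extend p q q≢p first l p≤l l<q with toℕ p ℕₚ.≟ toℕ l
  ... | no  p≢l = first l (ℕₚ.≤∧≢⇒< p≤l p≢l) l<q
  ... | yes p≡l = λ Pl≡Pq → q≢p (trans (sym Pl≡Pq) (cong P (toℕ-injective (sym p≡l))))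

  -- One scanning step preserves the invariant; for the bin of p this is where
  -- validity (no two consecutive items of one color in a bin) is used.
  guarded-next : ∀ S (p : Pos L) → Guarded S (toℕ p) → Guarded (next S p) (suc (toℕ p))
  guarded-next S p g q armed p<q qc first with P q ≟ᶠ P p
  ... | no  q≢p = g q (trans (sym (lookup∘update′ q≢p S _)) armed) (ℕₚ.<⇒≤ p<q) qc
                    (first-extend p q q≢p first)
  ... | yes q≡p with colorAt p ≟ᶠ c
  ...   | yes pc = proj₂ valid p q consecutive (trans pc (sym qc))
    where
    -- p and q, both c-colored, would be consecutive items of one bin.
    consecutive : ConsecutiveIn L P p q
    consecutive = p<q , sym q≡p , λ l p<l l<q Pl≡Pp → first l p<l l<q (trans Pl≡Pp (sym q≡p))
  ...   | no  _  = contradiction (trans (sym armed) disarmed) λ ()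
    where
    -- p was not c-colored, so its bin (which is q's) has just been disarmed.
    disarmed : lookup (S [ P p ]≔ outside) (P q) ≡ outside
    disarmed = trans (cong (lookup (S [ P p ]≔ outside)) q≡p) (lookup∘update (P p) S outside)

  step-paid : ∀ S (p : Pos L) → Guarded S (toℕ p) →
    s c (List.lookup L p) ℤ.+ + ∣ S ∣ ℤ.≤ + ∣ next S p ∣
  step-paid S p g with colorAt p ≟ᶠ c
  ... | yes pc = ℤₚ.≤-reflexive (cong +_ (sym (size-insert S (P p) (unarmed S p g pc))))
  ... | no  _  = ℤₚ.+-monoʳ-≤ (ℤ.- + 1) (ℤ.+≤+ (size-remove S (P p)))

  window-start : ∀ a t → a + suc t ≤ length L → Σ[ p ∈ Pos L ] toℕ p ≡ a
  window-start a t fits = fromℕ< a<n , toℕ-fromℕ< a<n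
    where
    a<n : a < length L
    a<n = ℕₚ.<-≤-trans (ℕₚ.m<m+n a (s≤s z≤n)) fits

  bound : ∀ t a (S : Subset m) → a + t ≤ length L → Guarded S a →
    window-sum c L a t ℤ.+ + ∣ S ∣ ℤ.≤ + m
  bound zero    a S _    _ = ℤ.+≤+ (∣p∣≤n S)
  bound (suc t) a S fits g
    with window-start a t fits
  ... | p , refl = begin
    window-sum c L (toℕ p) (suc t) ℤ.+ + ∣ S ∣
      ≡⟨ cong (ℤ._+ + ∣ S ∣) (window-sum-step c L p t) ⟩
    (x ℤ.+ rest) ℤ.+ + ∣ S ∣
      ≡⟨ cong (ℤ._+ + ∣ S ∣) (ℤₚ.+-comm x rest) ⟩
    (rest ℤ.+ x) ℤ.+ + ∣ S ∣
      ≡⟨ ℤₚ.+-assoc rest x (+ ∣ S ∣) ⟩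
    rest ℤ.+ (x ℤ.+ + ∣ S ∣)
      ≤⟨ ℤₚ.+-monoʳ-≤ rest (step-paid S p g) ⟩
    rest ℤ.+ + ∣ next S p ∣
      ≤⟨ bound t (suc (toℕ p)) (next S p) (subst (_≤ length L) (ℕₚ.+-suc (toℕ p) t) fits)
           (guarded-next S p g) ⟩
    + m ∎
    where
    open ℤₚ.≤-Reasoning
    x : ℤ.ℤ
    x = s c (List.lookup L p)
    rest : ℤ.ℤ
    rest = window-sum c L (suc (toℕ p)) t

  guarded-∅ : ∀ a → Guarded Subset.⊥ a
  guarded-∅ a q armed = contradiction (trans (sym (lookup-replicate (P q) outside)) armed) λ ()

lemma2p2 : (k : ℕ) (L : Seq k) (m : ℕ) (P : Packing L m) → Valid L P →
    (c : Fin k) (i j : ℕ) → i ≤ j → j < length L →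
    discrepancy c L i j ℤ.≤ + m
lemma2p2 k L m P valid c i j i≤j j<n =
  subst (ℤ._≤ + m) no-armed-bins (bound t i Subset.⊥ window-fits (guarded-∅ i))
  where
  open Scan L P valid c
  open ≡-Reasoning
  t : ℕ
  t = suc j ∸ i
  window-fits : i + t ≤ length L
  window-fits = subst (_≤ length L) (sym (ℕₚ.m+[n∸m]≡n (ℕₚ.m≤n⇒m≤1+n i≤j))) j<n
  no-armed-bins : window-sum c L i t ℤ.+ + ∣ Subset.⊥ {m} ∣ ≡ discrepancy c L i j
  no-armed-bins = begin
    window-sum c L i t ℤ.+ + ∣ Subset.⊥ {m} ∣ ≡⟨ cong (λ n → window-sum c L i t ℤ.+ + n) (∣⊥∣≡0 m) ⟩
    window-sum c L i t ℤ.+ + 0                ≡⟨ ℤₚ.+-identityʳ _ ⟩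
    window-sum c L i t                        ≡⟨ cong (λ n → window-sum c L i (n ∸ i)) (ℕₚ.+-comm 1 j) ⟩
    discrepancy c L i j                       ∎
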